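{- Let $T=(V,E)$ be a tree on $n$ vertices rooted at $r$. Let $U\subseteq V$ and let $e_i=(u_i,v_i)$, $i=1,\dots,k$, be the edges of $T$ with one endpoint in $U$ and the other in $V\setminus U$, where each edge is written so that $\mathrm{lev}(u_i)=\mathrm{lev}(v_i)-1$. Then $$|U|=\mathbb 1_U(r)\cdot n+\sum_{i=1}^k(-1)^{\mathbb 1_U(u_i)}\cdot n_{v_i}.$$
   Context: For a rooted tree, $\mathrm{lev}(v)$ is the distance from $v$ to the root. For a vertex $v$, $n_v$ denotes the number of vertices of the subtree of $T$ rooted at $v$ (i.e., $v$ and all its descendants). $\mathbb 1_U(v)=1$ if $v\in U$ and $0$ otherwise. -}

module Defs where

open import Data.Bool using (Bool; true; false; if_then_else_; _xor_)
open import Data.Nat using (ℕ; zero; suc; _+_; _<ᵇ_)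
open import Data.Integer as ℤ using (ℤ; +_; -1ℤ; 0ℤ)
open import Data.List using (List; []; _∷_; _++_; map; foldr; filterᵇ)
open import Data.Product using (_×_; _,_; proj₁; proj₂)

-- A finite rooted tree: the root together with the (finite) list of
-- subtrees rooted at its children.  Every finite rooted tree arises this way.
data RTree : Set where
  node : List RTree → RTree

-- Vertices of a rooted tree, as positions (paths from the root).
mutual
  data Pos : RTree → Set where
    root : ∀ {t} → Pos t
    down : ∀ {ts} → ChildPos ts → Pos (node ts)

  data ChildPos : List RTree → Set where
    hd : ∀ {t ts} → Pos t → ChildPos (t ∷ ts)
    tl : ∀ {t ts} → ChildPos ts → ChildPos (t ∷ ts)

mutual
  vertices : (t : RTree) → List (Pos t)
  vertices (node ts) = root ∷ map down (verticesL ts)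

  verticesL : (ts : List RTree) → List (ChildPos ts)
  verticesL [] = []
  verticesL (t ∷ ts) = map hd (vertices t) ++ map tl (verticesL ts)

mutual
  size : RTree → ℕ
  size (node ts) = suc (sizeL ts)

  sizeL : List RTree → ℕ
  sizeL [] = 0
  sizeL (t ∷ ts) = size t + sizeL ts

mutual
  subtree : ∀ {t} → Pos t → RTree
  subtree {t} root = t
  subtree (down c) = subtreeL c

  subtreeL : ∀ {ts} → ChildPos ts → RTree
  subtreeL (hd p) = subtree p
  subtreeL (tl c) = subtreeL c

nsub : ∀ {t} → Pos t → ℕ
nsub v = size (subtree v)

mutual
  lev : ∀ {t} → Pos t → ℕ
  lev root = 0
  lev (down c) = suc (levL c)

  levL : ∀ {ts} → ChildPos ts → ℕ
  levL (hd p) = lev p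
  levL (tl c) = levL c

-- the edges of the tree (each edge {parent, child} listed once, as a pair)
mutual
  edges : (t : RTree) → List (Pos t × Pos t)
  edges (node ts) =
    map (λ c → root , down c) (childRoots ts)
    ++ map (λ e → down (proj₁ e) , down (proj₂ e)) (edgesL ts)

  edgesL : (ts : List RTree) → List (ChildPos ts × ChildPos ts)
  edgesL [] = []
  edgesL (t ∷ ts) =
    map (λ e → hd (proj₁ e) , hd (proj₂ e)) (edges t)
    ++ map (λ e → tl (proj₁ e) , tl (proj₂ e)) (edgesL ts)

  childRoots : (ts : List RTree) → List (ChildPos ts)
  childRoots [] = []
  childRoots (t ∷ ts) = hd root ∷ map tl (childRoots ts)

𝟙 : ∀ {t} → (Pos t → Bool) → Pos t → ℕ
𝟙 U v = if U v then 1 else 0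

card : (t : RTree) → (Pos t → Bool) → ℕ
card t U = foldr _+_ 0 (map (𝟙 U) (vertices t))

crossing : (t : RTree) → (Pos t → Bool) → List (Pos t × Pos t)
crossing t U = filterᵇ (λ e → U (proj₁ e) xor U (proj₂ e)) (edges t)

orient : ∀ {t} → Pos t × Pos t → Pos t × Pos t
orient (a , b) = if lev a <ᵇ lev b then (a , b) else (b , a)

sumℤ : List ℤ → ℤ
sumℤ = foldr ℤ._+_ 0ℤ

term : ∀ {t} → (Pos t → Bool) → Pos t × Pos t → ℤ
term U e = (-1ℤ ℤ.^ 𝟙 U (proj₁ (orient e))) ℤ.* (+ nsub (proj₂ (orient e)))

-- If the root r has children c₁ … c_m, then
-- |U| = 1_U(r) + Σ_j |U ∩ T_{c_j}|, and by induction
-- |U ∩ T_{c_j}| = 1_U(c_j)·n_{c_j} + (crossing terms inside T_{c_j}).  The identity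
--   1_U(c)·n_c = 1_U(r)·n_c + [r c crosses U]·(-1)^{1_U(r)}·n_c
-- turns each leading term into 1_U(r)·n_{c_j} plus the term of the edge r c_j,
-- and 1 + Σ_j n_{c_j} = n.  Trees and forests are handled simultaneously, a
-- forest carrying the U-bit of its parent.
module Submission where

open import Defs
open import Data.Bool using (Bool; true; false; if_then_else_; _xor_)
open import Data.Nat as ℕ using (ℕ; _<ᵇ_)
open import Data.Nat.ListAction using (sum)
open import Data.Nat.ListAction.Properties using (sum-++)
open import Data.Integer using (ℤ; +_; -_; _+_; _*_; -1ℤ; 0ℤ; _^_)
open import Data.Integer.Properties
  using (pos-+; +-assoc; +-identityˡ; +-identityʳ; *-identityˡ; *-zeroˡ; *-zeroʳ; +-inverseʳ; -1*i≡-i)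
open import Data.Integer.Tactic.RingSolver using (solve-∀)
open import Data.List using (List; []; _∷_; _++_; map; filterᵇ)
open import Data.List.Properties using (map-++; map-∘; map-cong)
open import Data.Product using (_×_; _,_; proj₁; proj₂)
open import Function using (_∘_)
open import Relation.Binary.PropositionalEquality using (_≡_; refl; sym; trans; cong; cong₂; module ≡-Reasoning)
open ≡-Reasoning

ind : Bool → ℕ
ind b = if b then 1 else 0

sign : Bool → ℤ
sign b = -1ℤ ^ ind b

-- The change of  1_U · s  along an edge from a parent with U-bit x to a child with U-bit y.
jump : Bool → Bool → ℤ → ℤ
jump x y s = if x xor y then sign x * s else 0ℤ

ind*≡ind*+jump : ∀ x y (s : ℤ) → + ind y * s ≡ + ind x * s + jump x y s
ind*≡ind*+jump true  true  s = sym (+-identityʳ _)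
ind*≡ind*+jump false false s = sym (+-identityʳ _)
ind*≡ind*+jump false true  s = begin
  + 1 * s            ≡⟨ sym (+-identityˡ _) ⟩
  0ℤ + + 1 * s       ≡⟨ cong (_+ + 1 * s) (sym (*-zeroˡ s)) ⟩
  + 0 * s + + 1 * s  ∎
ind*≡ind*+jump true  false s = begin
  + 0 * s            ≡⟨ *-zeroˡ s ⟩
  0ℤ                 ≡⟨ sym (+-inverseʳ s) ⟩
  s + - s            ≡⟨ cong₂ _+_ (sym (*-identityˡ s)) (sym (-1*i≡-i s)) ⟩
  + 1 * s + -1ℤ * s  ∎

sumℤ-++ : (xs ys : List ℤ) → sumℤ (xs ++ ys) ≡ sumℤ xs + sumℤ ys
sumℤ-++ []       ys = sym (+-identityˡ _)
sumℤ-++ (x ∷ xs) ys = trans (cong (_+_ x) (sumℤ-++ xs ys)) (sym (+-assoc x _ _))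

sumℤ-map-filterᵇ : {A : Set} (f : A → ℤ) (p : A → Bool) (xs : List A) →
  sumℤ (map f (filterᵇ p xs)) ≡ sumℤ (map (λ a → if p a then f a else 0ℤ) xs)
sumℤ-map-filterᵇ f p []       = refl
sumℤ-map-filterᵇ f p (x ∷ xs) with p x
... | true  = cong (_+_ (f x)) (sumℤ-map-filterᵇ f p xs)
... | false = trans (sumℤ-map-filterᵇ f p xs) (sym (+-identityˡ _))

sumℤ-map-++-map : {A B C : Set} (f : C → ℤ) (g : A → C) (h : B → C) (xs : List A) (ys : List B) →
  sumℤ (map f (map g xs ++ map h ys)) ≡ sumℤ (map (f ∘ g) xs) + sumℤ (map (f ∘ h) ys)
sumℤ-map-++-map f g h xs ys = begin
  sumℤ (map f (map g xs ++ map h ys))                ≡⟨ cong sumℤ (map-++ f (map g xs) (map h ys)) ⟩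
  sumℤ (map f (map g xs) ++ map f (map h ys))        ≡⟨ sumℤ-++ (map f (map g xs)) _ ⟩
  sumℤ (map f (map g xs)) + sumℤ (map f (map h ys))  ≡⟨ cong₂ (λ l l′ → sumℤ l + sumℤ l′) (sym (map-∘ xs)) (sym (map-∘ ys)) ⟩
  sumℤ (map (f ∘ g) xs) + sumℤ (map (f ∘ h) ys)      ∎

sum-map-++-map : {A B C : Set} (f : C → ℕ) (g : A → C) (h : B → C) (xs : List A) (ys : List B) →
  sum (map f (map g xs ++ map h ys)) ≡ sum (map (f ∘ g) xs) ℕ.+ sum (map (f ∘ h) ys)
sum-map-++-map f g h xs ys = begin
  sum (map f (map g xs ++ map h ys))                 ≡⟨ cong sum (map-++ f (map g xs) (map h ys)) ⟩
  sum (map f (map g xs) ++ map f (map h ys))         ≡⟨ sum-++ (map f (map g xs)) _ ⟩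
  sum (map f (map g xs)) ℕ.+ sum (map f (map h ys))  ≡⟨ cong₂ (λ l l′ → sum l ℕ.+ sum l′) (sym (map-∘ xs)) (sym (map-∘ ys)) ⟩
  sum (map (f ∘ g) xs) ℕ.+ sum (map (f ∘ h) ys)      ∎

-- Stated for an arbitrary vertex type so that it also covers forests (ChildPos);
-- edgeTerm lev nsub U is term U.
module _ {V : Set} (lv n : V → ℕ) (U : V → Bool) where

  orientBy : V × V → V × V
  orientBy (a , b) = if lv a <ᵇ lv b then (a , b) else (b , a)

  edgeTerm : V × V → ℤ
  edgeTerm e = sign (U (proj₁ (orientBy e))) * + n (proj₂ (orientBy e))

  crossWeight : V × V → ℤ
  crossWeight e = if U (proj₁ e) xor U (proj₂ e) then edgeTerm e else 0ℤ

crossWeight-map : {V W : Set} (lv : V → ℕ) (lv′ n′ : W → ℕ) (U′ : W → Bool) (g : V → W) →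
  (∀ a b → (lv′ (g a) <ᵇ lv′ (g b)) ≡ (lv a <ᵇ lv b)) → (e : V × V) →
  crossWeight lv′ n′ U′ (g (proj₁ e) , g (proj₂ e)) ≡ crossWeight lv (n′ ∘ g) (U′ ∘ g) e
crossWeight-map lv lv′ n′ U′ g g-preserves-order (a , b)
  rewrite g-preserves-order a b with lv a <ᵇ lv b
... | true  = refl
... | false = refl

cardF : (ts : List RTree) → (ChildPos ts → Bool) → ℕ
cardF ts W = sum (map (ind ∘ W) (verticesL ts))

crossSum : (t : RTree) → (Pos t → Bool) → ℤ
crossSum t U = sumℤ (map (crossWeight lev nsub U) (edges t))

crossSumF : (ts : List RTree) → (ChildPos ts → Bool) → ℤ
crossSumF ts W = sumℤ (map (crossWeight levL (size ∘ subtreeL) W) (edgesL ts))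

rootJumps : Bool → (ts : List RTree) → (ChildPos ts → Bool) → ℤ
rootJumps x ts W = sumℤ (map (λ c → jump x (W c) (+ size (subtreeL c))) (childRoots ts))

card-node : ∀ ts (U : Pos (node ts) → Bool) → card (node ts) U ≡ ind (U root) ℕ.+ cardF ts (U ∘ down)
card-node ts U = cong (λ l → ind (U root) ℕ.+ sum l) (sym (map-∘ (verticesL ts)))

cardF-∷ : ∀ t ts (W : ChildPos (t ∷ ts) → Bool) →
  cardF (t ∷ ts) W ≡ card t (W ∘ hd) ℕ.+ cardF ts (W ∘ tl)
cardF-∷ t ts W = sum-map-++-map (ind ∘ W) hd tl (vertices t) (verticesL ts)

crossSum-node : ∀ ts (U : Pos (node ts) → Bool) →
  crossSum (node ts) U ≡ rootJumps (U root) ts (U ∘ down) + crossSumF ts (U ∘ down)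
crossSum-node ts U = trans
  (sumℤ-map-++-map (crossWeight lev nsub U) _ _ (childRoots ts) (edgesL ts))
  (cong (_+_ (rootJumps (U root) ts (U ∘ down))) (cong sumℤ (map-cong (crossWeight-map levL lev nsub U down (λ _ _ → refl)) (edgesL ts))))

crossSumF-∷ : ∀ t ts (W : ChildPos (t ∷ ts) → Bool) →
  crossSumF (t ∷ ts) W ≡ crossSum t (W ∘ hd) + crossSumF ts (W ∘ tl)
crossSumF-∷ t ts W = trans
  (sumℤ-map-++-map (crossWeight levL (size ∘ subtreeL) W) _ _ (edges t) (edgesL ts))
  (cong₂ (λ l l′ → sumℤ l + sumℤ l′)
    (map-cong (crossWeight-map lev levL (size ∘ subtreeL) W hd (λ _ _ → refl)) (edges t))
    (map-cong (crossWeight-map levL levL (size ∘ subtreeL) W tl (λ _ _ → refl)) (edgesL ts)))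

rootJumps-∷ : ∀ x t ts (W : ChildPos (t ∷ ts) → Bool) →
  rootJumps x (t ∷ ts) W ≡ jump x (W (hd root)) (+ size t) + rootJumps x ts (W ∘ tl)
rootJumps-∷ x t ts W =
  cong (_+_ (jump x (W (hd root)) (+ size t)) ∘ sumℤ) (sym (map-∘ {g = λ c → jump x (W c) (+ size (subtreeL c))} {f = tl} (childRoots ts)))

mutual
  card≡ : (t : RTree) (U : Pos t → Bool) →
    + card t U ≡ + ind (U root) * + size t + crossSum t U
  card≡ (node ts) U = begin
    + card (node ts) U                           ≡⟨ cong +_ (card-node ts U) ⟩
    + (ind (U root) ℕ.+ cardF ts (U ∘ down))     ≡⟨ pos-+ (ind (U root)) _ ⟩
    X + + cardF ts (U ∘ down)                    ≡⟨ cong (_+_ X) (cardF≡ ts (U root) (U ∘ down)) ⟩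
    X + (X * + sizeL ts + (J + S))               ≡⟨ regroup X (+ sizeL ts) (J + S) ⟩
    X * (+ 1 + + sizeL ts) + (J + S)             ≡⟨ cong₂ (λ s c → X * s + c) (sym (pos-+ 1 (sizeL ts))) (sym (crossSum-node ts U)) ⟩
    X * + size (node ts) + crossSum (node ts) U  ∎
    where
    X = + ind (U root)
    J = rootJumps (U root) ts (U ∘ down)
    S = crossSumF ts (U ∘ down)
    regroup : ∀ a s c → a + (a * s + c) ≡ a * (+ 1 + s) + c
    regroup = solve-∀

  cardF≡ : (ts : List RTree) (x : Bool) (W : ChildPos ts → Bool) →
    + cardF ts W ≡ + ind x * + sizeL ts + (rootJumps x ts W + crossSumF ts W)
  cardF≡ []       x W = sym (trans (+-identityʳ _) (*-zeroʳ (+ ind x)))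
  cardF≡ (t ∷ ts) x W = begin
    + cardF (t ∷ ts) W                                ≡⟨ cong +_ (cardF-∷ t ts W) ⟩
    + (card t (W ∘ hd) ℕ.+ cardF ts (W ∘ tl))         ≡⟨ pos-+ (card t (W ∘ hd)) _ ⟩
    + card t (W ∘ hd) + + cardF ts (W ∘ tl)           ≡⟨ cong₂ _+_ (card≡ t (W ∘ hd)) (cardF≡ ts x (W ∘ tl)) ⟩
    + ind y * s + S + (X * s′ + (J + S′))             ≡⟨ cong (λ a → a + S + (X * s′ + (J + S′))) (ind*≡ind*+jump x y s) ⟩
    X * s + jump x y s + S + (X * s′ + (J + S′))      ≡⟨ regroup X s s′ (jump x y s) J S S′ ⟩
    X * (s + s′) + ((jump x y s + J) + (S + S′))
      ≡⟨ cong₂ (λ a b → X * a + b) (sym (pos-+ (size t) (sizeL ts)))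
               (cong₂ _+_ (sym (rootJumps-∷ x t ts W)) (sym (crossSumF-∷ t ts W))) ⟩
    X * + sizeL (t ∷ ts) + (rootJumps x (t ∷ ts) W + crossSumF (t ∷ ts) W)  ∎
    where
    X = + ind x
    y = W (hd root)
    s = + size t
    s′ = + sizeL ts
    J = rootJumps x ts (W ∘ tl)
    S = crossSum t (W ∘ hd)
    S′ = crossSumF ts (W ∘ tl)
    regroup : ∀ a s s′ j r c c′ → (a * s + j + c) + (a * s′ + (r + c′)) ≡ a * (s + s′) + ((j + r) + (c + c′))
    regroup = solve-∀

lemma7 : (T : RTree) (U : Pos T → Bool) →
    + card T U ≡ (+ 𝟙 U root) * (+ size T) + sumℤ (map (term U) (crossing T U))
lemma7 T U = begin
  + card T U                                            ≡⟨ card≡ T U ⟩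
  + 𝟙 U root * + size T + crossSum T U                  ≡⟨ cong (_+_ (+ 𝟙 U root * + size T)) (sym (sumℤ-map-filterᵇ (term U) _ (edges T))) ⟩
  + 𝟙 U root * + size T + sumℤ (map (term U) (crossing T U))  ∎
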